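{- Let $\mathbf{L}$ be an intermediate logic, $\mathbf{LJL}_0\in\{\mathbf{LJ}_0,\mathbf{LJT}_0,\mathbf{LJ4}_0,\mathbf{LJT4}_0\}$ and $CS$ a constant specification for $\mathbf{LJL}_0$. Let $\mathsf C$ be a class of complete Heyting algebras with respect to which $\mathbf L$ is strongly complete, and let $\mathsf{CASJL}$ be the class of algebraic subset models over algebras in $\mathsf C$ corresponding to $\mathbf{LJL}_0$ (all for $\mathbf{LJ}_0$; reflexive for $\mathbf{LJT}_0$; introspective for $\mathbf{LJ4}_0$; reflexive and introspective for $\mathbf{LJT4}_0$), $\mathsf{CASJL}_{CS}$ its subclass of models respecting $CS$, and $\mathsf{CASJL^c}_{CS}$ the accessibility-crisp models in the latter. For any $\Gamma\cup\{\phi\}\subseteq\mathcal L_J$ the following are equivalent: (1) $\Gamma\vdash_{\mathbf{LJL}_{CS}}\phi$; (2) $\Gamma\models_{\mathsf{CASJL}_{CS}}\phi$; (3) $\Gamma\models^1_{\mathsf{CASJL}_{CS}}\phi$; (4) $\Gamma\models^1_{\mathsf{CASJL^c}_{CS}}\phi$.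
   Context: Intermediate logic $\mathbf L\subsetneq\mathcal L_0$ (propositional language over $Var=\{p_i\}$ with $\bot,\land,\lor,\to$): contains all instances of the standard intuitionistic axiom schemes ($\phi\to(\psi\to\phi)$; $(\phi\to(\chi\to\psi))\to((\phi\to\chi)\to(\phi\to\psi))$; $(\phi\land\psi)\to\phi$; $(\phi\land\psi)\to\psi$; $\phi\to(\psi\to(\phi\land\psi))$; $\phi\to(\phi\lor\psi)$; $\psi\to(\phi\lor\psi)$; $(\phi\to\psi)\to((\chi\to\psi)\to((\phi\lor\chi)\to\psi))$; $\bot\to\phi$), closed under modus ponens and substitution. $\mathbf L$ is strongly complete w.r.t. $\mathsf C$ iff for all $\Gamma\cup\{\phi\}\subseteq\mathcal L_0$: [some $\bigwedge_{i\le n}\gamma_i\to\phi\in\mathbf L$, $\gamma_i\in\Gamma$] iff for every $\mathbf A\in\mathsf C$ and homomorphic evaluation $f:\mathcal L_0\to A$, $f[\Gamma]\subseteq\{1\}$ implies $f(\phi)=1$. Terms $Jt$: $t::=x\mid c\mid[t+t]\mid[t\cdot t]\mid\,!t$ ($x\in V=\{x_i\}$, $c\in C=\{c_i\}$); $\mathcal L_J$: $\phi::=\bot\mid p\mid\phi\land\phi\mid\phi\lor\phi\mid\phi\to\phi\mid t:\phi$. $\overline{\mathbf L}$: all $\sigma(\psi)$, $\psi\in\mathbf L$, $\sigma:Var\to\mathcal L_J$. Schemes $(J)$ $t:(\phi\to\psi)\to(s:\phi\to[t\cdot s]:\psi)$; $(+)$ $t:\phi\to[t+s]:\phi$, $t:\phi\to[s+t]:\phi$;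 $(F)$ $t:\phi\to\phi$; $(I)$ $t:\phi\to\,!t:t:\phi$. $\mathbf{LJ}_0$ = closure of $\overline{\mathbf L}\cup(J)\cup(+)$ under modus ponens; $\mathbf{LJT}_0$ adds $(F)$, $\mathbf{LJ4}_0$ adds $(I)$, $\mathbf{LJT4}_0$ both. Constant specification for $\mathbf{LJL}_0$: set of formulas $c_{i_n}:\dots:c_{i_1}:\phi$ ($n\ge1$) with $\phi\in\overline{\mathbf L}$ or an instance of a justification scheme of $\mathbf{LJL}_0$. $\Gamma\vdash_{\mathbf{LJL}_{CS}}\phi$ iff $\bigwedge_{i\le n}\gamma_i\to\phi\in\mathbf{LJL}_0$ for some $\gamma_i\in\Gamma\cup CS$ ($n\ge0$). An algebraic subset model is $\mathfrak M=\langle\mathbf A,\mathcal W,\mathcal W_0,\mathcal E,\mathcal V\rangle$: $\mathbf A$ a complete Heyting algebra, $\emptyset\ne\mathcal W_0\subseteq\mathcal W$, $\mathcal E:Jt\times\mathcal W\times\mathcal W\to A$ (written $\mathcal E_t(w,v)$), $\mathcal V:\mathcal W\times\mathcal L_J\to A$ such that for every $w\in\mathcal W_0$: $\mathcal V(w,\cdot)$ commutes with $\bot,\land,\lor,\to$; $\mathcal V(w,t:\phi)=\bigwedge\{\mathcal E_t(w,v)\to\mathcal V(v,\phi)\mid v\in\mathcal W\}$; and (regularity) for all $v\in\mathcal W$, $s,t\in Jt$: $\mathcal E_{s+t}(w,v)\le\mathcal E_s(w,v)\land\mathcal E_t(w,v)$ and $\mathcal E_{s\cdot t}(w,v)\le\bigwedge\{M^w_{s,t}(\psi)\to\mathcal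 V(v,\psi)\mid\psi\in\mathcal L_J\}$ where $M^w_{s,t}(\psi)=\bigvee\{\mathcal V(w,s:(\phi\to\psi))\land\mathcal V(w,t:\phi)\mid\phi\in\mathcal L_J\}$. Reflexive: $\mathcal E_t(w,w)=1$ for all $w\in\mathcal W_0$, $t$. Introspective: $\mathcal E_{!t}(w,v)\le\bigwedge\{\mathcal V(w,t:\phi)\to\mathcal V(v,t:\phi)\mid\phi\in\mathcal L_J\}$ for all $w\in\mathcal W_0$, $v\in\mathcal W$, $t$. Accessibility-crisp: $\mathcal E_t(w,v)\in\{0,1\}$ for all $t$ and $w,v\in\mathcal W_0$. Respects $CS$: $\mathcal V(w,\chi)=1$ for all $\chi\in CS$, $w\in\mathcal W_0$. For a class $\mathsf K$: $\Gamma\models_{\mathsf K}\phi$ iff for all models and all $w\in\mathcal W_0$, $\bigwedge\{\mathcal V(w,\gamma)\mid\gamma\in\Gamma\}\le\mathcal V(w,\phi)$; $\Gamma\models^1_{\mathsf K}\phi$ iff for all models and $w\in\mathcal W_0$, $\mathcal V(w,\gamma)=1$ for all $\gamma\in\Gamma$ implies $\mathcal V(w,\phi)=1$. -}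

module Defs where

open import Level using (Level; Lift; lift; _⊔_) renaming (suc to lsuc; zero to lzero)
open import Data.Nat using (ℕ)
open import Data.List using (List; []; _∷_)
open import Data.List.Relation.Unary.All using (All)
open import Data.Product using (Σ; _×_; _,_; ∃)
open import Data.Sum using (_⊎_)
open import Relation.Nullary using (¬_)
open import Relation.Binary.PropositionalEquality using (_≡_)
open import Relation.Binary.Lattice.Bundles using (HeytingAlgebra)
open import Function.Bundles using (_⇔_)

data Fm₀ : Set where
  ⊥₀   : Fm₀
  var₀ : ℕ → Fm₀
  _∧₀_ _∨₀_ _⇒₀_ : Fm₀ → Fm₀ → Fm₀

⊤₀ : Fm₀
⊤₀ = ⊥₀ ⇒₀ ⊥₀

conj₀ : List Fm₀ → Fm₀
conj₀ []       = ⊤₀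
conj₀ (γ ∷ γs) = γ ∧₀ conj₀ γs

subst₀ : (ℕ → Fm₀) → Fm₀ → Fm₀
subst₀ σ ⊥₀       = ⊥₀
subst₀ σ (var₀ i) = σ i
subst₀ σ (a ∧₀ b) = subst₀ σ a ∧₀ subst₀ σ b
subst₀ σ (a ∨₀ b) = subst₀ σ a ∨₀ subst₀ σ b
subst₀ σ (a ⇒₀ b) = subst₀ σ a ⇒₀ subst₀ σ b

data IntAx : Fm₀ → Set where
  ax1 : ∀ φ ψ → IntAx (φ ⇒₀ (ψ ⇒₀ φ))
  ax2 : ∀ φ χ ψ → IntAx ((φ ⇒₀ (χ ⇒₀ ψ)) ⇒₀ ((φ ⇒₀ χ) ⇒₀ (φ ⇒₀ ψ)))
  ax3 : ∀ φ ψ → IntAx ((φ ∧₀ ψ) ⇒₀ φ)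
  ax4 : ∀ φ ψ → IntAx ((φ ∧₀ ψ) ⇒₀ ψ)
  ax5 : ∀ φ ψ → IntAx (φ ⇒₀ (ψ ⇒₀ (φ ∧₀ ψ)))
  ax6 : ∀ φ ψ → IntAx (φ ⇒₀ (φ ∨₀ ψ))
  ax7 : ∀ φ ψ → IntAx (ψ ⇒₀ (φ ∨₀ ψ))
  ax8 : ∀ φ ψ χ → IntAx ((φ ⇒₀ ψ) ⇒₀ ((χ ⇒₀ ψ) ⇒₀ ((φ ∨₀ χ) ⇒₀ ψ)))
  ax9 : ∀ φ → IntAx (⊥₀ ⇒₀ φ)

record IntermediateLogic : Set₁ where
  field
    L      : Fm₀ → Set
    axioms : ∀ φ → IntAx φ → L φ
    mp     : ∀ φ ψ → L (φ ⇒₀ ψ) → L φ → L ψ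
    subst  : ∀ (σ : ℕ → Fm₀) φ → L φ → L (subst₀ σ φ)
    proper : Σ Fm₀ (λ φ → ¬ L φ)

record CompleteHeytingAlgebra (c ℓ₁ ℓ₂ : Level) : Set (lsuc (c ⊔ ℓ₁ ⊔ ℓ₂)) where
  field
    heyting : HeytingAlgebra c ℓ₁ ℓ₂
  open HeytingAlgebra heyting public
  field
    ⋀ : {I : Set c} → (I → Carrier) → Carrier
    ⋁ : {I : Set c} → (I → Carrier) → Carrier
    ⋀-lower    : {I : Set c} (f : I → Carrier) (i : I) → ⋀ f ≤ f i
    ⋀-greatest : {I : Set c} (f : I → Carrier) (x : Carrier) → (∀ i → x ≤ f i) → x ≤ ⋀ f
    ⋁-upper    : {I : Set c} (f : I → Carrier) (i : I) → f i ≤ ⋁ f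
    ⋁-least    : {I : Set c} (f : I → Carrier) (x : Carrier) → (∀ i → f i ≤ x) → ⋁ f ≤ x

module _ {c ℓ₁ ℓ₂ : Level} (A : CompleteHeytingAlgebra c ℓ₁ ℓ₂) where
  open CompleteHeytingAlgebra A

  record IsHomEval (f : Fm₀ → Carrier) : Set (ℓ₁) where
    field
      hom-⊥ : f ⊥₀ ≈ ⊥
      hom-∧ : ∀ a b → f (a ∧₀ b) ≈ (f a ∧ f b)
      hom-∨ : ∀ a b → f (a ∨₀ b) ≈ (f a ∨ f b)
      hom-⇒ : ∀ a b → f (a ⇒₀ b) ≈ (f a ⇨ f b)

StronglyComplete : {c ℓ₁ ℓ₂ p : Level} → IntermediateLogic →
  (CompleteHeytingAlgebra c ℓ₁ ℓ₂ → Set p) → Set (lsuc (c ⊔ ℓ₁ ⊔ ℓ₂) ⊔ p)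
StronglyComplete {c} {ℓ₁} {ℓ₂} 𝐋 C =
  ∀ (Γ : Fm₀ → Set) (φ : Fm₀) →
    (Σ (List Fm₀) (λ γs → All Γ γs × IntermediateLogic.L 𝐋 (conj₀ γs ⇒₀ φ)))
    ⇔ (∀ (A : CompleteHeytingAlgebra c ℓ₁ ℓ₂) → C A →
         ∀ (f : Fm₀ → CompleteHeytingAlgebra.Carrier A) → IsHomEval A f →
         (∀ γ → Γ γ → CompleteHeytingAlgebra._≈_ A (f γ) (CompleteHeytingAlgebra.⊤ A)) →
         CompleteHeytingAlgebra._≈_ A (f φ) (CompleteHeytingAlgebra.⊤ A))

data Tm : Set where
  vr   : ℕ → Tm
  cn   : ℕ → Tm
  _⊕_  : Tm → Tm → Tm
  _⊙_  : Tm → Tm → Tm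
  !_   : Tm → Tm

data Fm : Set where
  ⊥ᴶ   : Fm
  var  : ℕ → Fm
  _∧ᴶ_ _∨ᴶ_ _⇒ᴶ_ : Fm → Fm → Fm
  _∶_  : Tm → Fm → Fm

⊤ᴶ : Fm
⊤ᴶ = ⊥ᴶ ⇒ᴶ ⊥ᴶ

conj : List Fm → Fm
conj []       = ⊤ᴶ
conj (γ ∷ γs) = γ ∧ᴶ conj γs

inst : (ℕ → Fm) → Fm₀ → Fm
inst σ ⊥₀       = ⊥ᴶ
inst σ (var₀ i) = σ i
inst σ (a ∧₀ b) = inst σ a ∧ᴶ inst σ b
inst σ (a ∨₀ b) = inst σ a ∨ᴶ inst σ b
inst σ (a ⇒₀ b) = inst σ a ⇒ᴶ inst σ b

Lbar : IntermediateLogic → Fm → Set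
Lbar 𝐋 φ = Σ Fm₀ (λ ψ → Σ (ℕ → Fm) (λ σ → IntermediateLogic.L 𝐋 ψ × φ ≡ inst σ ψ))

data Kind : Set where
  J JT J4 JT4 : Kind

data HasT : Kind → Set where
  JT-T  : HasT JT
  JT4-T : HasT JT4

data Has4 : Kind → Set where
  J4-4  : Has4 J4
  JT4-4 : Has4 JT4

data JAx (k : Kind) : Fm → Set where
  axJ  : ∀ t s φ ψ → JAx k ((t ∶ (φ ⇒ᴶ ψ)) ⇒ᴶ ((s ∶ φ) ⇒ᴶ ((t ⊙ s) ∶ ψ)))
  ax+l : ∀ t s φ → JAx k ((t ∶ φ) ⇒ᴶ ((t ⊕ s) ∶ φ))
  ax+r : ∀ t s φ → JAx k ((t ∶ φ) ⇒ᴶ ((s ⊕ t) ∶ φ))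
  axF  : HasT k → ∀ t φ → JAx k ((t ∶ φ) ⇒ᴶ φ)
  axI  : Has4 k → ∀ t φ → JAx k ((t ∶ φ) ⇒ᴶ ((! t) ∶ (t ∶ φ)))

data LJL₀ (𝐋 : IntermediateLogic) (k : Kind) : Fm → Set where
  lbar : ∀ φ → Lbar 𝐋 φ → LJL₀ 𝐋 k φ
  jax  : ∀ φ → JAx k φ → LJL₀ 𝐋 k φ
  mp   : ∀ φ ψ → LJL₀ 𝐋 k (φ ⇒ᴶ ψ) → LJL₀ 𝐋 k φ → LJL₀ 𝐋 k ψ

data CSShape (𝐋 : IntermediateLogic) (k : Kind) : Fm → Set where
  base : ∀ i φ → (Lbar 𝐋 φ ⊎ JAx k φ) → CSShape 𝐋 k (cn i ∶ φ)
  step : ∀ j χ → CSShape 𝐋 k χ → CSShape 𝐋 k (cn j ∶ χ)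

record ConstSpec (𝐋 : IntermediateLogic) (k : Kind) : Set₁ where
  field
    CS    : Fm → Set
    shape : ∀ χ → CS χ → CSShape 𝐋 k χ

_⊢[_,_,_]_ : (Fm → Set) → (𝐋 : IntermediateLogic) → (k : Kind) → ConstSpec 𝐋 k → Fm → Set
Γ ⊢[ 𝐋 , k , cs ] φ =
  Σ (List Fm) (λ γs → All (λ γ → Γ γ ⊎ ConstSpec.CS cs γ) γs × LJL₀ 𝐋 k (conj γs ⇒ᴶ φ))

record SubsetModel {c ℓ₁ ℓ₂ : Level} (A : CompleteHeytingAlgebra c ℓ₁ ℓ₂)
       : Set (lsuc c ⊔ ℓ₁ ⊔ ℓ₂) where
  open CompleteHeytingAlgebra A
  field
    W  : Set c
    W₀ : W → Set c
    W₀-nonempty : Σ W W₀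
    E  : Tm → W → W → Carrier
    V  : W → Fm → Carrier
  M : W → Tm → Tm → Fm → Carrier
  M w s t ψ = ⋁ {Lift c Fm} (λ { (lift φ) → V w (s ∶ (φ ⇒ᴶ ψ)) ∧ V w (t ∶ φ) })
  field
    V-⊥ : ∀ w → W₀ w → V w ⊥ᴶ ≈ ⊥
    V-∧ : ∀ w → W₀ w → ∀ a b → V w (a ∧ᴶ b) ≈ (V w a ∧ V w b)
    V-∨ : ∀ w → W₀ w → ∀ a b → V w (a ∨ᴶ b) ≈ (V w a ∨ V w b)
    V-⇒ : ∀ w → W₀ w → ∀ a b → V w (a ⇒ᴶ b) ≈ (V w a ⇨ V w b)
    V-∶ : ∀ w → W₀ w → ∀ t φ → V w (t ∶ φ) ≈ ⋀ {W} (λ v → E t w v ⇨ V v φ)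
    reg-+ : ∀ w → W₀ w → ∀ v s t → E (s ⊕ t) w v ≤ (E s w v ∧ E t w v)
    reg-· : ∀ w → W₀ w → ∀ v s t →
              E (s ⊙ t) w v ≤ ⋀ {Lift c Fm} (λ { (lift ψ) → M w s t ψ ⇨ V v ψ })

module _ {c ℓ₁ ℓ₂ : Level} {A : CompleteHeytingAlgebra c ℓ₁ ℓ₂} (𝔐 : SubsetModel A) where
  open CompleteHeytingAlgebra A
  open SubsetModel 𝔐

  Reflexive : Set (c ⊔ ℓ₁)
  Reflexive = ∀ w → W₀ w → ∀ t → E t w w ≈ ⊤

  Introspective : Set (c ⊔ ℓ₂)
  Introspective = ∀ w → W₀ w → ∀ v t →
    E (! t) w v ≤ ⋀ {Lift c Fm} (λ { (lift φ) → V w (t ∶ φ) ⇨ V v (t ∶ φ) })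

  AccessibilityCrisp : Set (c ⊔ ℓ₁)
  AccessibilityCrisp = ∀ t w v → W₀ w → W₀ v → (E t w v ≈ ⊥) ⊎ (E t w v ≈ ⊤)

  RespectsCS : (Fm → Set) → Set (c ⊔ ℓ₁)
  RespectsCS CS = ∀ χ → CS χ → ∀ w → W₀ w → V w χ ≈ ⊤

FitsKind : {c ℓ₁ ℓ₂ : Level} {A : CompleteHeytingAlgebra c ℓ₁ ℓ₂} →
           Kind → SubsetModel A → Set (c ⊔ ℓ₁ ⊔ ℓ₂)
FitsKind {c} {ℓ₁} {ℓ₂} J   𝔐 = Lift (c ⊔ ℓ₁ ⊔ ℓ₂) Data.Unit.⊤
  where import Data.Unit
FitsKind {c} {ℓ₁} {ℓ₂} JT  𝔐 = Lift (c ⊔ ℓ₁ ⊔ ℓ₂) (Reflexive 𝔐)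
FitsKind {c} {ℓ₁} {ℓ₂} J4  𝔐 = Lift (c ⊔ ℓ₁ ⊔ ℓ₂) (Introspective 𝔐)
FitsKind JT4 𝔐 = Reflexive 𝔐 × Introspective 𝔐

module _ {c ℓ₁ ℓ₂ p : Level} (C : CompleteHeytingAlgebra c ℓ₁ ℓ₂ → Set p)
         (k : Kind) (CS : Fm → Set) where

  ⊨CAS : (Fm → Set) → Fm → Set (lsuc (c ⊔ ℓ₁ ⊔ ℓ₂) ⊔ p)
  ⊨CAS Γ φ = ∀ (A : CompleteHeytingAlgebra c ℓ₁ ℓ₂) → C A →
    ∀ (𝔐 : SubsetModel A) → FitsKind k 𝔐 → RespectsCS 𝔐 CS →
    ∀ w → SubsetModel.W₀ 𝔐 w →
    CompleteHeytingAlgebra._≤_ A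
      (CompleteHeytingAlgebra.⋀ A {Lift c (Σ Fm Γ)} (λ { (lift (γ , _)) → SubsetModel.V 𝔐 w γ }))
      (SubsetModel.V 𝔐 w φ)

  ⊨¹CAS : (Fm → Set) → Fm → Set (lsuc (c ⊔ ℓ₁ ⊔ ℓ₂) ⊔ p)
  ⊨¹CAS Γ φ = ∀ (A : CompleteHeytingAlgebra c ℓ₁ ℓ₂) → C A →
    ∀ (𝔐 : SubsetModel A) → FitsKind k 𝔐 → RespectsCS 𝔐 CS →
    ∀ w → SubsetModel.W₀ 𝔐 w →
    (∀ γ → Γ γ → CompleteHeytingAlgebra._≈_ A (SubsetModel.V 𝔐 w γ) (CompleteHeytingAlgebra.⊤ A)) →
    CompleteHeytingAlgebra._≈_ A (SubsetModel.V 𝔐 w φ) (CompleteHeytingAlgebra.⊤ A)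

  ⊨¹CASᶜ : (Fm → Set) → Fm → Set (lsuc (c ⊔ ℓ₁ ⊔ ℓ₂) ⊔ p)
  ⊨¹CASᶜ Γ φ = ∀ (A : CompleteHeytingAlgebra c ℓ₁ ℓ₂) → C A →
    ∀ (𝔐 : SubsetModel A) → FitsKind k 𝔐 → RespectsCS 𝔐 CS → AccessibilityCrisp 𝔐 →
    ∀ w → SubsetModel.W₀ 𝔐 w →
    (∀ γ → Γ γ → CompleteHeytingAlgebra._≈_ A (SubsetModel.V 𝔐 w γ) (CompleteHeytingAlgebra.⊤ A)) →
    CompleteHeytingAlgebra._≈_ A (SubsetModel.V 𝔐 w φ) (CompleteHeytingAlgebra.⊤ A)

-- Soundness (1 ⇒ 2): at a normal world w of a model over A ∈ C, the map
-- χ ↦ V(w, σχ) is a homomorphic evaluation, so every member of L̄ is true there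
-- by strong completeness of L; the justification axioms are true by the
-- regularity, reflexivity and introspection conditions; hence every theorem
-- of LJL₀ is true and ⋀Γ ≤ V(w, φ) whenever Γ ⊢ φ.  Steps 2 ⇒ 3 ⇒ 4 are
-- immediate.
-- Completeness (4 ⇒ 1): replace every atom and every assertion t : χ by a
-- fresh propositional variable (the skeleton of a formula, using an explicit
-- Gödel numbering of L_J).  Given any evaluation f of skeletons making the
-- hypotheses, the constant specification and all LJL₀-theorems true, a
-- canonical model with one normal world (valued by f) and one non-normal
-- world for each term u (valued by f on u : _) satisfies (4), so f makes φ
-- true.  Strong completeness of L then yields a propositional derivation,
-- which decodes to an LJL₀-derivation from Γ, CS and LJL₀-theorems; the
-- theorems are finally discharged from the list of premisses.
module Submission where

open import Defs
open import Level using (Level; Lift; lift; _⊔_) renaming (suc to lsuc)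
open import Data.Nat using (ℕ; zero; suc)
open import Data.Product using (Σ; _×_; _,_; proj₁; proj₂)
open import Data.Sum using (_⊎_; inj₁; inj₂)
open import Data.List using (List; []; _∷_)
open import Data.List.Relation.Unary.All using (All; []; _∷_)
open import Data.Maybe using (Maybe; nothing; just)
open import Data.Unit using (tt) renaming (⊤ to Unit)
open import Data.Empty using () renaming (⊥ to Empty)
open import Function.Base using (_∘_)
open import Function.Bundles using (_⇔_; mk⇔; Equivalence)
open import Relation.Binary.PropositionalEquality as ≡ using (_≡_; refl; cong; cong₂)

module Coding where
  open import Data.Nat using (_+_; _≤_; s≤s) renaming (_⊔_ to _⊔ₙ_)
  import Data.Nat.Properties as ℕₚ

  -- Cantor's enumeration of ℕ × ℕ along the anti-diagonals a + b = s,
  -- each traversed from (0 , s) to (s , 0).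
  next : ℕ × ℕ → ℕ × ℕ
  next (a , suc b) = (suc a , b)
  next (a , zero)  = (zero , suc a)

  unpair : ℕ → ℕ × ℕ
  unpair zero    = (0 , 0)
  unpair (suc n) = next (unpair n)

  -- triangle s counts the pairs on the diagonals before the s-th one.
  triangle : ℕ → ℕ
  triangle zero    = zero
  triangle (suc s) = suc (triangle s + s)

  pair : ℕ → ℕ → ℕ
  pair a b = triangle (a + b) + a

  unpair-diagonal : ∀ s a b → a + b ≡ s → unpair (triangle s + a) ≡ (a , b)
  unpair-diagonal s (suc a) b eq
    rewrite ℕₚ.+-suc (triangle s) a
          | unpair-diagonal s a (suc b) (≡.trans (ℕₚ.+-suc a b) eq) = refl
  unpair-diagonal zero    zero b refl = refl
  unpair-diagonal (suc s) zero b eq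
    rewrite ℕₚ.+-identityʳ (triangle s + s)
          | unpair-diagonal s s zero (ℕₚ.+-identityʳ s) = cong (zero ,_) (≡.sym eq)

  unpair-pair : ∀ a b → unpair (pair a b) ≡ (a , b)
  unpair-pair a b = unpair-diagonal (a + b) a b refl

  codeTm : Tm → ℕ
  codeTm (vr i)  = pair 0 i
  codeTm (cn i)  = pair 1 i
  codeTm (t ⊕ s) = pair 2 (pair (codeTm t) (codeTm s))
  codeTm (t ⊙ s) = pair 3 (pair (codeTm t) (codeTm s))
  codeTm (! t)   = pair 4 (codeTm t)

  codeFm : Fm → ℕ
  codeFm ⊥ᴶ       = pair 0 0
  codeFm (var i)  = pair 1 i
  codeFm (a ∧ᴶ b) = pair 2 (pair (codeFm a) (codeFm b))
  codeFm (a ∨ᴶ b) = pair 3 (pair (codeFm a) (codeFm b))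
  codeFm (a ⇒ᴶ b) = pair 4 (pair (codeFm a) (codeFm b))
  codeFm (t ∶ a)  = pair 5 (pair (codeTm t) (codeFm a))

  -- The depth bounds the number of decoding steps needed.
  depthTm : Tm → ℕ
  depthTm (vr i)  = 1
  depthTm (cn i)  = 1
  depthTm (t ⊕ s) = suc (depthTm t ⊔ₙ depthTm s)
  depthTm (t ⊙ s) = suc (depthTm t ⊔ₙ depthTm s)
  depthTm (! t)   = suc (depthTm t)

  depthFm : Fm → ℕ
  depthFm ⊥ᴶ       = 1
  depthFm (var i)  = 1
  depthFm (a ∧ᴶ b) = suc (depthFm a ⊔ₙ depthFm b)
  depthFm (a ∨ᴶ b) = suc (depthFm a ⊔ₙ depthFm b)
  depthFm (a ⇒ᴶ b) = suc (depthFm a ⊔ₙ depthFm b)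
  depthFm (t ∶ a)  = suc (depthTm t ⊔ₙ depthFm a)

  decodeTm : ℕ → ℕ → Tm
  decodeTmNode : ℕ → ℕ × ℕ → Tm
  decodeTm zero    n = vr 0
  decodeTm (suc k) n = decodeTmNode k (unpair n)
  decodeTmNode k (0 , i) = vr i
  decodeTmNode k (1 , i) = cn i
  decodeTmNode k (2 , m) = decodeTm k (proj₁ (unpair m)) ⊕ decodeTm k (proj₂ (unpair m))
  decodeTmNode k (3 , m) = decodeTm k (proj₁ (unpair m)) ⊙ decodeTm k (proj₂ (unpair m))
  decodeTmNode k (4 , m) = ! decodeTm k m
  decodeTmNode k _       = vr 0

  decodeFm : ℕ → ℕ → Fm
  decodeFmNode : ℕ → ℕ × ℕ → Fm
  decodeFm zero    n = ⊥ᴶ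
  decodeFm (suc k) n = decodeFmNode k (unpair n)
  decodeFmNode k (0 , i) = ⊥ᴶ
  decodeFmNode k (1 , i) = var i
  decodeFmNode k (2 , m) = decodeFm k (proj₁ (unpair m)) ∧ᴶ decodeFm k (proj₂ (unpair m))
  decodeFmNode k (3 , m) = decodeFm k (proj₁ (unpair m)) ∨ᴶ decodeFm k (proj₂ (unpair m))
  decodeFmNode k (4 , m) = decodeFm k (proj₁ (unpair m)) ⇒ᴶ decodeFm k (proj₂ (unpair m))
  decodeFmNode k (5 , m) = decodeTm k (proj₁ (unpair m)) ∶ decodeFm k (proj₂ (unpair m))
  decodeFmNode k _       = ⊥ᴶ

  decodeTm-codeTm : ∀ t k → depthTm t ≤ k → decodeTm k (codeTm t) ≡ t
  decodeTm-codeTm (vr i) (suc k) _ rewrite unpair-pair 0 i = refl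
  decodeTm-codeTm (cn i) (suc k) _ rewrite unpair-pair 1 i = refl
  decodeTm-codeTm (t ⊕ s) (suc k) (s≤s d)
    rewrite unpair-pair 2 (pair (codeTm t) (codeTm s)) | unpair-pair (codeTm t) (codeTm s) =
    cong₂ _⊕_ (decodeTm-codeTm t k (ℕₚ.m⊔n≤o⇒m≤o _ _ d)) (decodeTm-codeTm s k (ℕₚ.m⊔n≤o⇒n≤o _ _ d))
  decodeTm-codeTm (t ⊙ s) (suc k) (s≤s d)
    rewrite unpair-pair 3 (pair (codeTm t) (codeTm s)) | unpair-pair (codeTm t) (codeTm s) =
    cong₂ _⊙_ (decodeTm-codeTm t k (ℕₚ.m⊔n≤o⇒m≤o _ _ d)) (decodeTm-codeTm s k (ℕₚ.m⊔n≤o⇒n≤o _ _ d))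
  decodeTm-codeTm (! t) (suc k) (s≤s d)
    rewrite unpair-pair 4 (codeTm t) = cong !_ (decodeTm-codeTm t k d)

  decodeFm-codeFm : ∀ a k → depthFm a ≤ k → decodeFm k (codeFm a) ≡ a
  decodeFm-codeFm ⊥ᴶ (suc k) _ rewrite unpair-pair 0 0 = refl
  decodeFm-codeFm (var i) (suc k) _ rewrite unpair-pair 1 i = refl
  decodeFm-codeFm (a ∧ᴶ b) (suc k) (s≤s d)
    rewrite unpair-pair 2 (pair (codeFm a) (codeFm b)) | unpair-pair (codeFm a) (codeFm b) =
    cong₂ _∧ᴶ_ (decodeFm-codeFm a k (ℕₚ.m⊔n≤o⇒m≤o _ _ d)) (decodeFm-codeFm b k (ℕₚ.m⊔n≤o⇒n≤o _ _ d))
  decodeFm-codeFm (a ∨ᴶ b) (suc k) (s≤s d)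
    rewrite unpair-pair 3 (pair (codeFm a) (codeFm b)) | unpair-pair (codeFm a) (codeFm b) =
    cong₂ _∨ᴶ_ (decodeFm-codeFm a k (ℕₚ.m⊔n≤o⇒m≤o _ _ d)) (decodeFm-codeFm b k (ℕₚ.m⊔n≤o⇒n≤o _ _ d))
  decodeFm-codeFm (a ⇒ᴶ b) (suc k) (s≤s d)
    rewrite unpair-pair 4 (pair (codeFm a) (codeFm b)) | unpair-pair (codeFm a) (codeFm b) =
    cong₂ _⇒ᴶ_ (decodeFm-codeFm a k (ℕₚ.m⊔n≤o⇒m≤o _ _ d)) (decodeFm-codeFm b k (ℕₚ.m⊔n≤o⇒n≤o _ _ d))
  decodeFm-codeFm (t ∶ a) (suc k) (s≤s d)
    rewrite unpair-pair 5 (pair (codeTm t) (codeFm a)) | unpair-pair (codeTm t) (codeFm a) =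
    cong₂ _∶_ (decodeTm-codeTm t k (ℕₚ.m⊔n≤o⇒m≤o _ _ d)) (decodeFm-codeFm a k (ℕₚ.m⊔n≤o⇒n≤o _ _ d))

  -- A formula is encoded together with the fuel its decoding needs.
  encode : Fm → ℕ
  encode a = pair (depthFm a) (codeFm a)

  decode : ℕ → Fm
  decode n = decodeFm (proj₁ (unpair n)) (proj₂ (unpair n))

  decode-encode : ∀ a → decode (encode a) ≡ a
  decode-encode a rewrite unpair-pair (depthFm a) (codeFm a) = decodeFm-codeFm a (depthFm a) ℕₚ.≤-refl

open Coding using (encode; decode; decode-encode)

skeleton : Fm → Fm₀
skeleton ⊥ᴶ       = ⊥₀
skeleton (var i)  = var₀ (encode (var i))
skeleton (a ∧ᴶ b) = skeleton a ∧₀ skeleton b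
skeleton (a ∨ᴶ b) = skeleton a ∨₀ skeleton b
skeleton (a ⇒ᴶ b) = skeleton a ⇒₀ skeleton b
skeleton (t ∶ a)  = var₀ (encode (t ∶ a))

inst-decode-skeleton : ∀ a → inst decode (skeleton a) ≡ a
inst-decode-skeleton ⊥ᴶ       = refl
inst-decode-skeleton (var i)  = decode-encode (var i)
inst-decode-skeleton (a ∧ᴶ b) = cong₂ _∧ᴶ_ (inst-decode-skeleton a) (inst-decode-skeleton b)
inst-decode-skeleton (a ∨ᴶ b) = cong₂ _∨ᴶ_ (inst-decode-skeleton a) (inst-decode-skeleton b)
inst-decode-skeleton (a ⇒ᴶ b) = cong₂ _⇒ᴶ_ (inst-decode-skeleton a) (inst-decode-skeleton b)
inst-decode-skeleton (t ∶ a)  = decode-encode (t ∶ a)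

SkeletonsOf : (Fm → Set) → Fm₀ → Set
SkeletonsOf S ψ = Σ Fm (λ γ → S γ × skeleton γ ≡ ψ)

decode-conj : ∀ {S : Fm → Set} γs → All (SkeletonsOf S) γs →
  Σ (List Fm) (λ δs → All S δs × inst decode (conj₀ γs) ≡ conj δs)
decode-conj [] [] = [] , [] , refl
decode-conj (._ ∷ γs) ((δ , δ∈S , refl) ∷ γs∈) =
  let δs , δs∈S , eq = decode-conj γs γs∈
  in  δ ∷ δs , δ∈S ∷ δs∈S , cong₂ _∧ᴶ_ (inst-decode-skeleton δ) eq

-- Δ ⊢⟨ 𝐋 , k ⟩ φ: some finite conjunction of members of Δ implies φ in LJL₀;
-- Γ ⊢[ 𝐋 , k , cs ] φ is the case Δ = Γ ∪ CS.
_⊢⟨_,_⟩_ : (Fm → Set) → IntermediateLogic → Kind → Fm → Set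
Δ ⊢⟨ 𝐋 , k ⟩ φ = Σ (List Fm) (λ δs → All Δ δs × LJL₀ 𝐋 k (conj δs ⇒ᴶ φ))

decode-derivation : ∀ {𝐋 k} {S : Fm → Set} {φ} →
  Σ (List Fm₀) (λ γs → All (SkeletonsOf S) γs × IntermediateLogic.L 𝐋 (conj₀ γs ⇒₀ skeleton φ)) →
  S ⊢⟨ 𝐋 , k ⟩ φ
decode-derivation {φ = φ} (γs , γs∈ , ⊢γs⇒φ) =
  let δs , δs∈S , decoded = decode-conj γs γs∈
  in  δs , δs∈S , lbar _ (_ , decode , ⊢γs⇒φ ,
                          cong₂ _⇒ᴶ_ (≡.sym decoded) (≡.sym (inst-decode-skeleton φ)))

-- Natural-deduction style reasoning in a complete Heyting algebra, the
-- context of the hypotheses being an element z.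
module HeytingReasoning {c ℓ₁ ℓ₂ : Level} (A : CompleteHeytingAlgebra c ℓ₁ ℓ₂) where
  open CompleteHeytingAlgebra A renaming (refl to ≤-refl; trans to ≤-trans)
  open import Relation.Binary.Lattice.Properties.HeytingAlgebra heyting using (⇨-eval)

  ∧-≤ˡ : ∀ {x y} → x ∧ y ≤ x
  ∧-≤ˡ = x∧y≤x _ _

  ∧-≤ʳ : ∀ {x y} → x ∧ y ≤ y
  ∧-≤ʳ = x∧y≤y _ _

  ⇨-mp : ∀ {z x y} → z ≤ x ⇨ y → z ≤ x → z ≤ y
  ⇨-mp p q = ≤-trans (∧-greatest p q) ⇨-eval

  ≤⇒⊤≤⇨ : ∀ {x y} → x ≤ y → ⊤ ≤ x ⇨ y
  ≤⇒⊤≤⇨ p = transpose-⇨ (≤-trans ∧-≤ʳ p)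

  ⊤≤⇒≈⊤ : ∀ {x} → ⊤ ≤ x → x ≈ ⊤
  ⊤≤⇒≈⊤ {x} p = antisym (maximum x) p

  ≈⊤⇒⊤≤ : ∀ {x} → x ≈ ⊤ → ⊤ ≤ x
  ≈⊤⇒⊤≤ e = reflexive (Eq.sym e)

  module Connectives {X : Set} (g : X → Carrier) (_⟶_ _&_ : X → X → X)
         (g-⟶ : ∀ a b → g (a ⟶ b) ≈ (g a ⇨ g b))
         (g-& : ∀ a b → g (a & b) ≈ (g a ∧ g b)) where

    ⟶-intro : ∀ {z a b} → z ∧ g a ≤ g b → z ≤ g (a ⟶ b)
    ⟶-intro p = ≤-trans (transpose-⇨ p) (reflexive (Eq.sym (g-⟶ _ _)))

    ⟶-elim : ∀ {z a b} → z ≤ g (a ⟶ b) → z ≤ g a → z ≤ g b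
    ⟶-elim p q = ⇨-mp (≤-trans p (reflexive (g-⟶ _ _))) q

    &-intro : ∀ {z a b} → z ≤ g a → z ≤ g b → z ≤ g (a & b)
    &-intro p q = ≤-trans (∧-greatest p q) (reflexive (Eq.sym (g-& _ _)))

    &-elimˡ : ∀ {z a b} → z ≤ g (a & b) → z ≤ g a
    &-elimˡ p = ≤-trans p (≤-trans (reflexive (g-& _ _)) ∧-≤ˡ)

    &-elimʳ : ∀ {z a b} → z ≤ g (a & b) → z ≤ g b
    &-elimʳ p = ≤-trans p (≤-trans (reflexive (g-& _ _)) ∧-≤ʳ)

    ⟶-valid : ∀ {a b} → ⊤ ≤ g (a ⟶ b) → g a ≤ g b
    ⟶-valid p = ⟶-elim (≤-trans (maximum _) p) ≤-refl

    ⟶-valid₁ : ∀ {a b} → g a ≤ g b → ⊤ ≤ g (a ⟶ b)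
    ⟶-valid₁ p = ⟶-intro (≤-trans ∧-≤ʳ p)

    ⟶-valid₂ : ∀ {a b d} → g a ∧ g b ≤ g d → ⊤ ≤ g (a ⟶ (b ⟶ d))
    ⟶-valid₂ p = ⟶-intro (⟶-intro (≤-trans (∧-greatest (≤-trans ∧-≤ˡ ∧-≤ʳ) ∧-≤ʳ) p))

fits-intro : ∀ {c ℓ₁ ℓ₂} {A : CompleteHeytingAlgebra c ℓ₁ ℓ₂} {𝔐 : SubsetModel A} k →
  (HasT k → Reflexive 𝔐) → (Has4 k → Introspective 𝔐) → FitsKind k 𝔐
fits-intro J   r i = lift tt
fits-intro JT  r i = lift (r JT-T)
fits-intro J4  r i = lift (i J4-4)
fits-intro JT4 r i = r JT4-T , i JT4-4

fits-reflexive : ∀ {c ℓ₁ ℓ₂} {A : CompleteHeytingAlgebra c ℓ₁ ℓ₂} {𝔐 : SubsetModel A} {k} →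
  HasT k → FitsKind k 𝔐 → Reflexive 𝔐
fits-reflexive JT-T  (lift r) = r
fits-reflexive JT4-T (r , _)  = r

fits-introspective : ∀ {c ℓ₁ ℓ₂} {A : CompleteHeytingAlgebra c ℓ₁ ℓ₂} {𝔐 : SubsetModel A} {k} →
  Has4 k → FitsKind k 𝔐 → Introspective 𝔐
fits-introspective J4-4  (lift i) = i
fits-introspective JT4-4 (_ , i)  = i

module StrongCompleteness {c ℓ₁ ℓ₂ p : Level} (𝐋 : IntermediateLogic)
       (C : CompleteHeytingAlgebra c ℓ₁ ℓ₂ → Set p) (SC : StronglyComplete 𝐋 C) where
  open IntermediateLogic 𝐋 using (L; axioms) renaming (mp to L-mp)
  open CompleteHeytingAlgebra using (Carrier; _≤_; ⊤)

  Valid : Fm₀ → Set (lsuc (c ⊔ ℓ₁ ⊔ ℓ₂) ⊔ p)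
  Valid ψ = ∀ (A : CompleteHeytingAlgebra c ℓ₁ ℓ₂) → C A →
            ∀ (f : Fm₀ → Carrier A) → IsHomEval A f → _≤_ A (⊤ A) (f ψ)

  theorem⇒valid : ∀ {ψ} → L ψ → Valid ψ
  theorem⇒valid {ψ} ⊢ψ A CA f hom = HeytingReasoning.≈⊤⇒⊤≤ A
    (Equivalence.to (SC (λ _ → Empty) ψ) ([] , [] , L-mp _ _ (axioms _ (ax1 ψ ⊤₀)) ⊢ψ)
       A CA f hom (λ _ ()))

  valid⇒theorem : ∀ {ψ} → Valid ψ → L ψ
  valid⇒theorem {ψ} valid
    with Equivalence.from (SC (λ _ → Empty) ψ)
           (λ A CA f hom _ → HeytingReasoning.⊤≤⇒≈⊤ A (valid A CA f hom))
  ... | [] , [] , ⊢⊤⇒ψ = L-mp _ _ ⊢⊤⇒ψ (axioms _ (ax9 ⊥₀))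

  valid-instance : ∀ {k ψ} → Valid ψ → ∀ σ → LJL₀ 𝐋 k (inst σ ψ)
  valid-instance valid σ = lbar _ (_ , σ , valid⇒theorem valid , refl)

  -- Three propositional tautologies used to move premisses in and out of a
  -- conjunction, with their validity in every Heyting algebra.
  p₀ p₁ p₂ : Fm₀
  p₀ = var₀ 0
  p₁ = var₀ 1
  p₂ = var₀ 2

  curry₀ curry-swap₀ uncurry-swap₀ : Fm₀
  curry₀        = ((p₀ ∧₀ p₁) ⇒₀ p₂) ⇒₀ (p₀ ⇒₀ (p₁ ⇒₀ p₂))
  curry-swap₀   = ((p₀ ∧₀ p₁) ⇒₀ p₂) ⇒₀ (p₁ ⇒₀ (p₀ ⇒₀ p₂))
  uncurry-swap₀ = (p₁ ⇒₀ (p₀ ⇒₀ p₂)) ⇒₀ ((p₀ ∧₀ p₁) ⇒₀ p₂)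

  module _ (A : CompleteHeytingAlgebra c ℓ₁ ℓ₂) (f : Fm₀ → Carrier A) (hom : IsHomEval A f) where
    open CompleteHeytingAlgebra A using (∧-greatest) renaming (trans to ≤-trans)
    open HeytingReasoning A
    open IsHomEval hom
    open Connectives f _⇒₀_ _∧₀_ hom-⇒ hom-∧

    curry-true : _≤_ A (⊤ A) (f curry₀)
    curry-true = ⟶-valid₁ (⟶-intro (⟶-intro
      (⟶-elim (≤-trans ∧-≤ˡ ∧-≤ˡ) (&-intro (≤-trans ∧-≤ˡ ∧-≤ʳ) ∧-≤ʳ))))

    curry-swap-true : _≤_ A (⊤ A) (f curry-swap₀)
    curry-swap-true = ⟶-valid₁ (⟶-intro (⟶-intro
      (⟶-elim (≤-trans ∧-≤ˡ ∧-≤ˡ) (&-intro ∧-≤ʳ (≤-trans ∧-≤ˡ ∧-≤ʳ)))))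

    uncurry-swap-true : _≤_ A (⊤ A) (f uncurry-swap₀)
    uncurry-swap-true = ⟶-valid₁ (⟶-intro
      (⟶-elim (⟶-elim ∧-≤ˡ (&-elimʳ ∧-≤ʳ)) (&-elimˡ ∧-≤ʳ)))

  [_,_,_] : Fm → Fm → Fm → ℕ → Fm
  [ a , b , d ] 0 = a
  [ a , b , d ] 1 = b
  [ a , b , d ] 2 = d
  [ a , b , d ] _ = ⊥ᴶ

  curry : ∀ {k} a b d → LJL₀ 𝐋 k (((a ∧ᴶ b) ⇒ᴶ d) ⇒ᴶ (a ⇒ᴶ (b ⇒ᴶ d)))
  curry a b d = valid-instance (λ A _ → curry-true A) [ a , b , d ]

  curry-swap : ∀ {k} a b d → LJL₀ 𝐋 k (((a ∧ᴶ b) ⇒ᴶ d) ⇒ᴶ (b ⇒ᴶ (a ⇒ᴶ d)))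
  curry-swap a b d = valid-instance (λ A _ → curry-swap-true A) [ a , b , d ]

  uncurry-swap : ∀ {k} a b d → LJL₀ 𝐋 k ((b ⇒ᴶ (a ⇒ᴶ d)) ⇒ᴶ ((a ∧ᴶ b) ⇒ᴶ d))
  uncurry-swap a b d = valid-instance (λ A _ → uncurry-swap-true A) [ a , b , d ]

  discharge : ∀ {k} {Q : Fm → Set} δs φ → All (λ δ → Q δ ⊎ LJL₀ 𝐋 k δ) δs →
    LJL₀ 𝐋 k (conj δs ⇒ᴶ φ) → Q ⊢⟨ 𝐋 , k ⟩ φ
  discharge [] φ [] ⊢φ = [] , [] , ⊢φ
  discharge (δ ∷ δs) φ (inj₂ ⊢δ ∷ δs∈) ⊢δδs⇒φ =
    discharge δs φ δs∈ (mp _ _ (mp _ _ (curry δ (conj δs) φ) ⊢δδs⇒φ) ⊢δ)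
  discharge (δ ∷ δs) φ (inj₁ δ∈Q ∷ δs∈) ⊢δδs⇒φ
    with discharge δs (δ ⇒ᴶ φ) δs∈ (mp _ _ (curry-swap δ (conj δs) φ) ⊢δδs⇒φ)
  ... | γs , γs∈Q , ⊢γs⇒δ⇒φ = δ ∷ γs , δ∈Q ∷ γs∈Q , mp _ _ (uncurry-swap δ (conj γs) φ) ⊢γs⇒δ⇒φ

module Soundness {c ℓ₁ ℓ₂ p : Level} (𝐋 : IntermediateLogic)
       (C : CompleteHeytingAlgebra c ℓ₁ ℓ₂ → Set p) (SC : StronglyComplete 𝐋 C)
       {A : CompleteHeytingAlgebra c ℓ₁ ℓ₂} (CA : C A) (k : Kind)
       (𝔐 : SubsetModel A) (fits : FitsKind k 𝔐)
       (w : SubsetModel.W 𝔐) (w₀ : SubsetModel.W₀ 𝔐 w) where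
  open CompleteHeytingAlgebra A renaming (refl to ≤-refl; trans to ≤-trans)
  open HeytingReasoning A
  open SubsetModel 𝔐
  open StrongCompleteness 𝐋 C SC using (theorem⇒valid)
  open Connectives (V w) _⇒ᴶ_ _∧ᴶ_ (V-⇒ w w₀) (V-∧ w w₀)

  ∶-intro : ∀ {z t χ} → (∀ v → z ∧ E t w v ≤ V v χ) → z ≤ V w (t ∶ χ)
  ∶-intro h = ≤-trans (⋀-greatest _ _ (λ v → transpose-⇨ (h v))) (reflexive (Eq.sym (V-∶ w w₀ _ _)))

  ∶-elim : ∀ {z t χ} v → z ≤ V w (t ∶ χ) → z ≤ E t w v → z ≤ V v χ
  ∶-elim v p q = ⇨-mp (≤-trans p (≤-trans (reflexive (V-∶ w w₀ _ _)) (⋀-lower _ v))) q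

  Lbar-true : ∀ {θ} → Lbar 𝐋 θ → ⊤ ≤ V w θ
  Lbar-true (ψ , σ , ⊢ψ , refl) = theorem⇒valid ⊢ψ A CA (λ χ → V w (inst σ χ)) V∘σ-hom
    where
    V∘σ-hom : IsHomEval A (λ χ → V w (inst σ χ))
    V∘σ-hom = record
      { hom-⊥ = V-⊥ w w₀
      ; hom-∧ = λ a b → V-∧ w w₀ (inst σ a) (inst σ b)
      ; hom-∨ = λ a b → V-∨ w w₀ (inst σ a) (inst σ b)
      ; hom-⇒ = λ a b → V-⇒ w w₀ (inst σ a) (inst σ b) }

  application : ∀ t s φ ψ → V w (t ∶ (φ ⇒ᴶ ψ)) ∧ V w (s ∶ φ) ≤ V w ((t ⊙ s) ∶ ψ)
  application t s φ ψ = ∶-intro λ v →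
    ⇨-mp (≤-trans ∧-≤ʳ (≤-trans (reg-· w w₀ v t s) (⋀-lower _ (lift ψ))))
         (≤-trans ∧-≤ˡ (⋁-upper _ (lift φ)))

  sumˡ : ∀ t s φ → V w (t ∶ φ) ≤ V w ((t ⊕ s) ∶ φ)
  sumˡ t s φ = ∶-intro λ v → ∶-elim v ∧-≤ˡ (≤-trans ∧-≤ʳ (≤-trans (reg-+ w w₀ v t s) ∧-≤ˡ))

  sumʳ : ∀ t s φ → V w (t ∶ φ) ≤ V w ((s ⊕ t) ∶ φ)
  sumʳ t s φ = ∶-intro λ v → ∶-elim v ∧-≤ˡ (≤-trans ∧-≤ʳ (≤-trans (reg-+ w w₀ v s t) ∧-≤ʳ))

  factivity : HasT k → ∀ t φ → V w (t ∶ φ) ≤ V w φ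
  factivity h t φ = ∶-elim w ≤-refl (≤-trans (maximum _) (≈⊤⇒⊤≤ (fits-reflexive h fits w w₀ t)))

  introspection : Has4 k → ∀ t φ → V w (t ∶ φ) ≤ V w ((! t) ∶ (t ∶ φ))
  introspection h t φ = ∶-intro λ v →
    ⇨-mp (≤-trans ∧-≤ʳ (≤-trans (fits-introspective h fits w w₀ v t) (⋀-lower _ (lift φ)))) ∧-≤ˡ

  JAx-true : ∀ {θ} → JAx k θ → ⊤ ≤ V w θ
  JAx-true (axJ t s φ ψ) = ⟶-valid₂ (application t s φ ψ)
  JAx-true (ax+l t s φ)  = ⟶-valid₁ (sumˡ t s φ)
  JAx-true (ax+r t s φ)  = ⟶-valid₁ (sumʳ t s φ)
  JAx-true (axF h t φ)   = ⟶-valid₁ (factivity h t φ)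
  JAx-true (axI h t φ)   = ⟶-valid₁ (introspection h t φ)

  theorem-true : ∀ {θ} → LJL₀ 𝐋 k θ → ⊤ ≤ V w θ
  theorem-true (lbar _ θ∈Lbar) = Lbar-true θ∈Lbar
  theorem-true (jax _ ax)      = JAx-true ax
  theorem-true (mp _ _ d e)    = ⟶-elim (theorem-true d) (theorem-true e)

  module _ (Γ CS : Fm → Set) (respects : RespectsCS 𝔐 CS) where
    ⋀Γ : Carrier
    ⋀Γ = ⋀ {Lift c (Σ Fm Γ)} (λ { (lift (γ , _)) → V w γ })

    conj-true : ∀ γs → All (λ γ → Γ γ ⊎ CS γ) γs → ⋀Γ ≤ V w (conj γs)
    conj-true [] [] = ⟶-intro ∧-≤ʳ
    conj-true (γ ∷ γs) (γ∈ ∷ γs∈) = &-intro (member γ∈) (conj-true γs γs∈)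
      where
      member : Γ γ ⊎ CS γ → ⋀Γ ≤ V w γ
      member (inj₁ γ∈Γ)  = ⋀-lower _ (lift (γ , γ∈Γ))
      member (inj₂ γ∈CS) = ≤-trans (maximum _) (≈⊤⇒⊤≤ (respects γ γ∈CS w w₀))

    derivation-true : ∀ {φ} → (λ γ → Γ γ ⊎ CS γ) ⊢⟨ 𝐋 , k ⟩ φ → ⋀Γ ≤ V w φ
    derivation-true (γs , γs∈ , ⊢γs⇒φ) =
      ⟶-elim (≤-trans (maximum _) (theorem-true ⊢γs⇒φ)) (conj-true γs γs∈)

-- The canonical model of an evaluation f of skeletons under which all
-- LJL₀-theorems are true: a normal world valued by f, and for every term u
-- a non-normal world valued by f on assertions u : _.
module Canonical {c ℓ₁ ℓ₂ : Level} (𝐋 : IntermediateLogic) (k : Kind)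
       {A : CompleteHeytingAlgebra c ℓ₁ ℓ₂}
       (f : Fm₀ → CompleteHeytingAlgebra.Carrier A) (hom : IsHomEval A f)
       (theorems-true : ∀ θ → LJL₀ 𝐋 k θ →
                        CompleteHeytingAlgebra._≈_ A (f (skeleton θ)) (CompleteHeytingAlgebra.⊤ A)) where
  open CompleteHeytingAlgebra A renaming (refl to ≤-refl; trans to ≤-trans)
  open HeytingReasoning A
  open IsHomEval hom
  open import Relation.Binary.Lattice.Properties.HeytingAlgebra heyting using (⇨ˡ-contravariant)

  val : Fm → Carrier
  val χ = f (skeleton χ)

  open Connectives val _⇒ᴶ_ _∧ᴶ_ (λ a b → hom-⇒ (skeleton a) (skeleton b))
                                 (λ a b → hom-∧ (skeleton a) (skeleton b))

  axiom-≤ : ∀ {a b} → JAx k (a ⇒ᴶ b) → val a ≤ val b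
  axiom-≤ ax = ⟶-valid (≈⊤⇒⊤≤ (theorems-true _ (jax _ ax)))

  application : ∀ s t φ ψ → val (s ∶ (φ ⇒ᴶ ψ)) ∧ val (t ∶ φ) ≤ val ((s ⊙ t) ∶ ψ)
  application s t φ ψ = ⟶-elim {a = t ∶ φ} {b = (s ⊙ t) ∶ ψ} (≤-trans ∧-≤ˡ (axiom-≤ (axJ s t φ ψ))) ∧-≤ʳ

  -- The normal world sees itself fully (⊤) in the systems with factivity and
  -- not at all (⊥) in the others; either way its self-access is crisp.
  selfAccess : Kind → Carrier
  selfAccess J   = ⊥
  selfAccess JT  = ⊤
  selfAccess J4  = ⊥
  selfAccess JT4 = ⊤

  selfAccess-crisp : ∀ k′ → (selfAccess k′ ≈ ⊥) ⊎ (selfAccess k′ ≈ ⊤)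
  selfAccess-crisp J   = inj₁ Eq.refl
  selfAccess-crisp JT  = inj₂ Eq.refl
  selfAccess-crisp J4  = inj₁ Eq.refl
  selfAccess-crisp JT4 = inj₂ Eq.refl

  selfAccess-reflexive : ∀ {k′} → HasT k′ → selfAccess k′ ≈ ⊤
  selfAccess-reflexive JT-T  = Eq.refl
  selfAccess-reflexive JT4-T = Eq.refl

  selfAccess-≤ : ∀ k′ {x} → (HasT k′ → ⊤ ≤ x) → selfAccess k′ ≤ x
  selfAccess-≤ J   _ = minimum _
  selfAccess-≤ JT  h = h JT-T
  selfAccess-≤ J4  _ = minimum _
  selfAccess-≤ JT4 h = h JT4-T

  -- the degree to which u justifies everything that t justifies
  dominance : Tm → Tm → Carrier
  dominance t u = ⋀ {Lift c Fm} (λ { (lift φ) → val (t ∶ φ) ⇨ val (u ∶ φ) })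

  dominance-refl : ∀ t → ⊤ ≤ dominance t t
  dominance-refl t = ⋀-greatest _ _ (λ { (lift φ) → ≤⇒⊤≤⇨ ≤-refl })

  dominance-antitone : ∀ t t′ u → (∀ φ → val (t ∶ φ) ≤ val (t′ ∶ φ)) → dominance t′ u ≤ dominance t u
  dominance-antitone t t′ u h = ⋀-greatest _ _ (λ { (lift φ) → ≤-trans (⋀-lower _ (lift φ)) (⇨ˡ-contravariant (h φ)) })

  World : Set c
  World = Lift c (Maybe Tm)

  pattern normal    = lift nothing
  pattern through u = lift (just u)

  Normal : World → Set c
  Normal normal      = Lift c Unit
  Normal (through _) = Lift c Empty

  access : Tm → World → World → Carrier
  access t normal normal      = selfAccess k
  access t normal (through u) = dominance t u
  access t (through _) _      = ⊥

  value : World → Fm → Carrier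
  value normal χ      = val χ
  value (through u) χ = val (u ∶ χ)

  factive-application : HasT k → ∀ s t φ ψ → val (s ∶ (φ ⇒ᴶ ψ)) ∧ val (t ∶ φ) ≤ val ψ
  factive-application h s t φ ψ = ⟶-elim {a = φ} {b = ψ}
    (≤-trans ∧-≤ˡ (axiom-≤ (axF h s (φ ⇒ᴶ ψ)))) (≤-trans ∧-≤ʳ (axiom-≤ (axF h t φ)))

  value-∶ : ∀ w → Normal w → ∀ t φ → value w (t ∶ φ) ≈ ⋀ {World} (λ v → access t w v ⇨ value v φ)
  value-∶ normal _ t φ = antisym
    (⋀-greatest _ _ λ
      { normal      → transpose-⇨ (⇨-mp (≤-trans ∧-≤ʳ (selfAccess-≤ k λ h → ≤⇒⊤≤⇨ (axiom-≤ (axF h t φ)))) ∧-≤ˡ)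
      ; (through u) → transpose-⇨ (⇨-mp (≤-trans ∧-≤ʳ (⋀-lower _ (lift φ))) ∧-≤ˡ) })
    (⇨-mp (⋀-lower _ (through t)) (≤-trans (maximum _) (dominance-refl t)))

  access-+ : ∀ w → Normal w → ∀ v s t → access (s ⊕ t) w v ≤ access s w v ∧ access t w v
  access-+ normal _ normal s t      = ∧-greatest ≤-refl ≤-refl
  access-+ normal _ (through u) s t = ∧-greatest (dominance-antitone s (s ⊕ t) u λ φ → axiom-≤ (ax+l s t φ))
                                                 (dominance-antitone t (s ⊕ t) u λ φ → axiom-≤ (ax+r t s φ))

  access-· : ∀ w → Normal w → ∀ v s t → access (s ⊙ t) w v ≤
    ⋀ {Lift c Fm} (λ { (lift ψ) →
      ⋁ {Lift c Fm} (λ { (lift φ) → value w (s ∶ (φ ⇒ᴶ ψ)) ∧ value w (t ∶ φ) }) ⇨ value v ψ })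
  access-· normal _ normal s t = selfAccess-≤ k λ h →
    ⋀-greatest _ _ λ { (lift ψ) → ≤⇒⊤≤⇨ (⋁-least _ _ λ { (lift φ) → factive-application h s t φ ψ }) }
  access-· normal _ (through u) s t = ⋀-greatest _ _ λ { (lift ψ) → transpose-⇨
    (⇨-mp (≤-trans ∧-≤ˡ (⋀-lower _ (lift ψ))) (≤-trans ∧-≤ʳ (⋁-least _ _ λ { (lift φ) → application s t φ ψ }))) }

  model : SubsetModel A
  model = record
    { W = World ; W₀ = Normal ; W₀-nonempty = normal , lift tt
    ; E = access ; V = value
    ; V-⊥ = λ { normal _ → hom-⊥ ; (through _) (lift ()) }
    ; V-∧ = λ { normal _ a b → hom-∧ (skeleton a) (skeleton b) ; (through _) (lift ()) }
    ; V-∨ = λ { normal _ a b → hom-∨ (skeleton a) (skeleton b) ; (through _) (lift ()) }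
    ; V-⇒ = λ { normal _ a b → hom-⇒ (skeleton a) (skeleton b) ; (through _) (lift ()) }
    ; V-∶ = value-∶
    ; reg-+ = access-+
    ; reg-· = access-·
    }

  model-reflexive : HasT k → Reflexive model
  model-reflexive h normal _ t = selfAccess-reflexive h

  model-introspective : Has4 k → Introspective model
  model-introspective h normal _ normal t =
    ⋀-greatest _ _ λ { (lift φ) → ≤-trans (maximum _) (≤⇒⊤≤⇨ ≤-refl) }
  model-introspective h normal _ (through u) t =
    ⋀-greatest _ _ λ { (lift φ) → ≤-trans (⋀-lower _ (lift (t ∶ φ))) (⇨ˡ-contravariant (axiom-≤ (axI h t φ))) }

  model-fits : FitsKind k model
  model-fits = fits-intro k model-reflexive model-introspective

  -- the only normal world is the canonical one, whose self-access is crisp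
  model-crisp : AccessibilityCrisp model
  model-crisp t normal normal _ _ = selfAccess-crisp k

  model-respects : ∀ {CS : Fm → Set} → (∀ χ → CS χ → f (skeleton χ) ≈ ⊤) → RespectsCS model CS
  model-respects CS-true χ χ∈CS normal _ = CS-true χ χ∈CS

soundness : {c ℓ₁ ℓ₂ p : Level} (𝐋 : IntermediateLogic) (k : Kind) (cs : ConstSpec 𝐋 k)
  (C : CompleteHeytingAlgebra c ℓ₁ ℓ₂ → Set p) → StronglyComplete 𝐋 C →
  ∀ Γ φ → Γ ⊢[ 𝐋 , k , cs ] φ → ⊨CAS C k (ConstSpec.CS cs) Γ φ
soundness 𝐋 k cs C SC Γ φ ⊢φ A CA 𝔐 fits respects w w₀ =
  Soundness.derivation-true 𝐋 C SC CA k 𝔐 fits w w₀ Γ (ConstSpec.CS cs) respects ⊢φ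

degree⇒truth : {c ℓ₁ ℓ₂ p : Level} {C : CompleteHeytingAlgebra c ℓ₁ ℓ₂ → Set p} {k : Kind}
  {CS Γ : Fm → Set} {φ : Fm} → ⊨CAS C k CS Γ φ → ⊨¹CAS C k CS Γ φ
degree⇒truth ⊨φ A CA 𝔐 fits respects w w₀ Γ-true = ⊤≤⇒≈⊤
  (trans (⋀-greatest _ _ λ { (lift (γ , γ∈Γ)) → ≈⊤⇒⊤≤ (Γ-true γ γ∈Γ) }) (⊨φ A CA 𝔐 fits respects w w₀))
  where open CompleteHeytingAlgebra A
        open HeytingReasoning A

truth⇒crisp-truth : {c ℓ₁ ℓ₂ p : Level} {C : CompleteHeytingAlgebra c ℓ₁ ℓ₂ → Set p} {k : Kind}
  {CS Γ : Fm → Set} {φ : Fm} → ⊨¹CAS C k CS Γ φ → ⊨¹CASᶜ C k CS Γ φ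
truth⇒crisp-truth ⊨φ A CA 𝔐 fits respects _ = ⊨φ A CA 𝔐 fits respects

completeness : {c ℓ₁ ℓ₂ p : Level} (𝐋 : IntermediateLogic) (k : Kind) (cs : ConstSpec 𝐋 k)
  (C : CompleteHeytingAlgebra c ℓ₁ ℓ₂ → Set p) → StronglyComplete 𝐋 C →
  ∀ Γ φ → ⊨¹CASᶜ C k (ConstSpec.CS cs) Γ φ → Γ ⊢[ 𝐋 , k , cs ] φ
completeness 𝐋 k cs C SC Γ φ ⊨φ =
  let δs , δs∈ , ⊢δs⇒φ = decode-derivation
                           (Equivalence.from (SC (SkeletonsOf Premiss) (skeleton φ)) skeleton-consequence)
  in  StrongCompleteness.discharge 𝐋 C SC δs φ δs∈ ⊢δs⇒φ
  where
  open ConstSpec cs using (CS)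

  Premiss : Fm → Set
  Premiss γ = (Γ γ ⊎ CS γ) ⊎ LJL₀ 𝐋 k γ

  -- every evaluation making the premisses true makes φ true: evaluate in
  -- the canonical model at its normal world
  skeleton-consequence : ∀ A → C A → ∀ f → IsHomEval A f →
    (∀ ψ → SkeletonsOf Premiss ψ → CompleteHeytingAlgebra._≈_ A (f ψ) (CompleteHeytingAlgebra.⊤ A)) →
    CompleteHeytingAlgebra._≈_ A (f (skeleton φ)) (CompleteHeytingAlgebra.⊤ A)
  skeleton-consequence A CA f hom premisses-true =
    ⊨φ A CA model model-fits (model-respects λ χ χ∈CS → premiss-true (inj₁ (inj₂ χ∈CS))) model-crisp
       normal (lift tt) (λ γ γ∈Γ → premiss-true (inj₁ (inj₁ γ∈Γ)))
    where
    premiss-true : ∀ {γ} → Premiss γ → CompleteHeytingAlgebra._≈_ A (f (skeleton γ)) (CompleteHeytingAlgebra.⊤ A)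
    premiss-true {γ} γ∈ = premisses-true (skeleton γ) (γ , γ∈ , refl)
    open Canonical 𝐋 k f hom (λ θ ⊢θ → premiss-true (inj₂ ⊢θ))

mainTheorem4 : {c ℓ₁ ℓ₂ p : Level} (𝐋 : IntermediateLogic) (k : Kind) (cs : ConstSpec 𝐋 k)
    (C : CompleteHeytingAlgebra c ℓ₁ ℓ₂ → Set p) → StronglyComplete 𝐋 C →
    (Γ : Fm → Set) (φ : Fm) →
    ((Γ ⊢[ 𝐋 , k , cs ] φ) ⇔ ⊨CAS C k (ConstSpec.CS cs) Γ φ)
    × ((Γ ⊢[ 𝐋 , k , cs ] φ) ⇔ ⊨¹CAS C k (ConstSpec.CS cs) Γ φ)
    × ((Γ ⊢[ 𝐋 , k , cs ] φ) ⇔ ⊨¹CASᶜ C k (ConstSpec.CS cs) Γ φ)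
mainTheorem4 𝐋 k cs C SC Γ φ =
  mk⇔ 1⇒2 (4⇒1 ∘ 3⇒4 ∘ 2⇒3) , mk⇔ (2⇒3 ∘ 1⇒2) (4⇒1 ∘ 3⇒4) , mk⇔ (3⇒4 ∘ 2⇒3 ∘ 1⇒2) 4⇒1
  where
  open ConstSpec cs using (CS)

  1⇒2 : Γ ⊢[ 𝐋 , k , cs ] φ → ⊨CAS C k CS Γ φ
  1⇒2 = soundness 𝐋 k cs C SC Γ φ

  2⇒3 : ⊨CAS C k CS Γ φ → ⊨¹CAS C k CS Γ φ
  2⇒3 = degree⇒truth

  3⇒4 : ⊨¹CAS C k CS Γ φ → ⊨¹CASᶜ C k CS Γ φ
  3⇒4 = truth⇒crisp-truth

  4⇒1 : ⊨¹CASᶜ C k CS Γ φ → Γ ⊢[ 𝐋 , k , cs ] φ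
  4⇒1 = completeness 𝐋 k cs C SC Γ φ
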